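{- For every $n\ge 0$, $$\Big(\frac{\partial}{\partial X}-(1+Y)\Big(1+\frac{\partial}{\partial Y}\Big)\Big)F_n(X,Y)=(1+Y)\sum_{k>0}\binom{n}{k}\Big(Y\frac{\partial}{\partial Y}\Big)^k\Big(1+\frac{\partial}{\partial Y}\Big)F_{n-k}(X,Y).$$
   Context: A marked set partition of $[n]$ is a set partition of $[n]=\{1,\dots,n\}$ with each block marked open or closed. For such $\lambda$ with blocks $\mathbf{B}_j$, let $o(\lambda)$ be the number of open blocks, $\ell(\lambda)$ the number of blocks, and $\tilde d(\lambda)=\sum_{\mathbf{B}_j\text{ closed}}\max(\mathbf{B}_j)-\sum_{\mathbf{B}_j}\min(\mathbf{B}_j)+\ell(\lambda)+n(o(\lambda)-1)$. Let $f(n;A,B)$ be the number of marked set partitions of $[n]$ with $o(\lambda)=A$, $\tilde d(\lambda)=B$, and let $F(X,Y,Z)=\sum_{n,A,B}f(n;A,B)\frac{X^n}{n!}Y^AZ^B$ (a formal power series in $X$ whose coefficients are Laurent polynomials in $Y,Z$). Define $F_k(X,Y)=\big(Z\frac{\partial}{\partial Z}\big)^kF(X,Y,Z)\big|_{Z=1}$. -}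

module Defs where

open import Data.Bool using (Bool; true; false; if_then_else_)
open import Data.Nat as ℕ using (ℕ; zero; suc; _⊓_; _⊔_; _≡ᵇ_)
open import Data.Nat.Combinatorics using (_C_)
open import Data.Integer as ℤ using (ℤ; +_; _-_; _*_; _^_)
open import Data.List as List using (List; []; _∷_; [_]; map; concatMap; foldr)
open import Data.List.NonEmpty as L⁺ using (List⁺; _∷⁺_; foldr₁)
open import Data.Product using (_×_; _,_; proj₁; proj₂)

-- Marked set partitions of [n] = {1,…,n}.
-- A block is a nonempty list of its elements together with a mark
-- (true = open, false = closed).  A marked set partition is a list of
-- marked blocks.

Block : Set
Block = List⁺ ℕ × Bool

MSP : Set
MSP = List Block

insEach : ℕ → MSP → List MSP
insEach m [] = []
insEach m ((b , o) ∷ bs) = ((m ∷⁺ b , o) ∷ bs) ∷ map ((b , o) ∷_) (insEach m bs)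

extend : ℕ → MSP → List MSP
extend m λ' = ((L⁺.[ m ] , true) ∷ λ') ∷ ((L⁺.[ m ] , false) ∷ λ') ∷ insEach m λ'

msps : ℕ → List MSP
msps zero = [ [] ]
msps (suc n) = concatMap (extend (suc n)) (msps n)

isOpen : Block → Bool
isOpen = proj₂

minB : Block → ℕ
minB (b , _) = foldr₁ _⊓_ b

maxB : Block → ℕ
maxB (b , _) = foldr₁ _⊔_ b

o : MSP → ℕ
o λ' = List.length (List.filterᵇ isOpen λ')

ℓ : MSP → ℕ
ℓ = List.length

sumℤ : List ℤ → ℤ
sumℤ = foldr ℤ._+_ (+ 0)

dtilde : ℕ → MSP → ℤ
dtilde n λ' =
  sumℤ (map (λ B → if isOpen B then + 0 else + maxB B) λ')
  - sumℤ (map (λ B → + minB B) λ')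
  ℤ.+ + ℓ λ'
  ℤ.+ (+ n) * (+ o λ' - + 1)

-- Formal power series in X, Y (exponential in X, ordinary in Y) with
-- integer coefficients:  s N A  is the coefficient of  X^N/N! · Y^A.

Series : Set
Series = ℕ → ℕ → ℤ

-- F_k(X,Y) = (Z ∂/∂Z)^k F(X,Y,Z) |_{Z=1}
--          = Σ_{N,A} ( Σ_{λ ∈ MSP(N), o(λ)=A} d̃(λ)^k ) X^N/N! Y^A
Fk : ℕ → Series
Fk k N A = sumℤ (map (λ λ' → if o λ' ≡ᵇ A then dtilde N λ' ^ k else + 0) (msps N))

_⊕_ : Series → Series → Series
(s ⊕ t) N A = s N A ℤ.+ t N A

_⊖_ : Series → Series → Series
(s ⊖ t) N A = s N A - t N A

-- ∂/∂X  (on X^N/N!:  X^{N+1}/(N+1)! ↦ X^N/N!)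
∂X : Series → Series
∂X s N A = s (suc N) A

∂Y : Series → Series
∂Y s N A = + suc A * s N (suc A)

mulY : Series → Series
mulY s N zero = + 0
mulY s N (suc A) = s N A

onePlusY : Series → Series
onePlusY s = s ⊕ mulY s

onePlus∂Y : Series → Series
onePlus∂Y s = s ⊕ ∂Y s

Y∂Y^ : ℕ → Series → Series
Y∂Y^ zero s = s
Y∂Y^ (suc k) s N A = + A * Y∂Y^ k s N A

scale : ℤ → Series → Series
scale c s N A = c * s N A

zeroS : Series
zeroS _ _ = + 0

sumFrom1 : ℕ → (ℕ → Series) → Series
sumFrom1 zero f = zeroS
sumFrom1 (suc n) f = sumFrom1 n f ⊕ f (suc n)

LHS : ℕ → Series
LHS n = ∂X (Fk n) ⊖ onePlusY (onePlus∂Y (Fk n))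

-- right-hand side: (1+Y) Σ_{k>0} C(n,k) (Y∂/∂Y)^k (1+∂/∂Y) F_{n−k}
-- (terms with k > n vanish since C(n,k) = 0; the sum runs over 1 ≤ k ≤ n)
RHS : ℕ → Series
RHS n = onePlusY (sumFrom1 n (λ k → scale (+ (n C k)) (Y∂Y^ k (onePlus∂Y (Fk (n ℕ.∸ k))))))

-- For a marked set partition π write k = o(π) and d = d̃(π).  Every partition
-- of [N+1] arises from exactly one partition of [N] by adding N+1 as an open
-- or closed singleton or by inserting it into an existing block.  The effect
-- on (o, d̃) is explicit, except for insertion into a closed block; there we
-- first open that block, and a double-counting argument (a partition with k
-- open blocks arises by opening a closed block in exactly k ways) turns this
-- into a factor k.  The result is the moment recursion `moment-suc`:
--   Σ_{μ ⊢ [N+1]} W(o μ, d̃ μ) = Σ_{π ⊢ [N]} extensionWeight W (o π) (d̃ π)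
-- for an arbitrary weight W.  Choosing W(k, d) = [k = A] dⁿ computes ∂F_n/∂X.
-- On the other side the binomial theorem collapses (1 + ∂_Y)F_n and the sum
-- over k > 0 into one moment sum, so that
--   ∂F_n/∂X = (1 + Y)((1 + ∂_Y)F_n + Σ_{k>0} C(n,k) (Y∂_Y)^k (1 + ∂_Y)F_{n−k}),
-- and the lemma follows by subtracting (1 + Y)(1 + ∂_Y)F_n.

module Submission where

open import Defs
open import Data.Nat using (ℕ)
open import Relation.Binary.PropositionalEquality using (_≡_)

open import Data.Bool using (true; false; if_then_else_)
open import Data.Nat using (zero; suc; pred; _≡ᵇ_; _≤_; _∸_)
open import Data.Nat.Properties
  using (≤-refl; ≤-reflexive; ≤-trans; m⊓n≤m; m≤m⊔n; m≥n⇒m⊔n≡m; m≥n⇒m⊓n≡n; m≤n⇒m≤1+n)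
open import Data.Nat.Combinatorics using (_C_)
open import Data.Integer using (ℤ; +_; _+_; _-_; _*_; _^_; 1ℤ)
import Data.Integer.Properties as ℤP
open import Data.Integer.Tactic.RingSolver using (solve-∀)
open import Data.List using (List; []; _∷_; map; concatMap; _++_)
open import Data.List.Properties using (map-cong; map-∘)
open import Data.List.NonEmpty as L⁺ using (_∷⁺_)
open import Data.List.Relation.Unary.All as All using (All; []; _∷_)
import Data.List.Relation.Unary.All.Properties as AllP
open import Data.Product using (_,_)
open import Data.Fin as Fin using (Fin; toℕ)
open import Data.Vec.Functional using (init; last)
open import Data.Fin.Properties using (toℕ-inject₁; toℕ-fromℕ)
open import Relation.Binary.PropositionalEquality
  using (refl; sym; trans; cong; cong₂; module ≡-Reasoning)
open import Algebra.Properties.Semiring.Sum ℤP.+-*-semiring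
  using (sum; sum-cong-≗; sum-init-last; *-distribˡ-sum)
import Algebra.Properties.Semiring.Mult ℤP.+-*-semiring as Mult
import Algebra.Properties.Semiring.Exp ℤP.+-*-semiring as Exp
import Algebra.Properties.CommutativeSemiring.Binomial ℤP.+-*-commutativeSemiring as Binomial

Σ : {X : Set} → (X → ℤ) → List X → ℤ
Σ f xs = sumℤ (map f xs)

Σ-cong : {X : Set} {f g : X → ℤ} → (∀ x → f x ≡ g x) → ∀ xs → Σ f xs ≡ Σ g xs
Σ-cong f≗g xs = cong sumℤ (map-cong f≗g xs)

Σ-congAll : {X : Set} {P : X → Set} {f g : X → ℤ} →
  (∀ {x} → P x → f x ≡ g x) → ∀ {xs} → All P xs → Σ f xs ≡ Σ g xs
Σ-congAll f≗g [] = refl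
Σ-congAll f≗g (px ∷ pxs) = cong₂ _+_ (f≗g px) (Σ-congAll f≗g pxs)

Σ-map : {X Y : Set} (f : Y → ℤ) (g : X → Y) (xs : List X) →
  Σ f (map g xs) ≡ Σ (λ x → f (g x)) xs
Σ-map f g xs = cong sumℤ (sym (map-∘ xs))

Σ-++ : {X : Set} (f : X → ℤ) (xs ys : List X) → Σ f (xs ++ ys) ≡ Σ f xs + Σ f ys
Σ-++ f [] ys = sym (ℤP.+-identityˡ _)
Σ-++ f (x ∷ xs) ys = trans (cong (_+_ (f x)) (Σ-++ f xs ys)) (sym (ℤP.+-assoc (f x) _ _))

Σ-concatMap : {X Y : Set} (f : Y → ℤ) (g : X → List Y) (xs : List X) →
  Σ f (concatMap g xs) ≡ Σ (λ x → Σ f (g x)) xs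
Σ-concatMap f g [] = refl
Σ-concatMap f g (x ∷ xs) =
  trans (Σ-++ f (g x) (concatMap g xs)) (cong (_+_ (Σ f (g x))) (Σ-concatMap f g xs))

Σ-+ : {X : Set} (f g : X → ℤ) (xs : List X) → Σ (λ x → f x + g x) xs ≡ Σ f xs + Σ g xs
Σ-+ f g [] = refl
Σ-+ f g (x ∷ xs) = trans (cong (_+_ (f x + g x)) (Σ-+ f g xs)) (interchange (f x) (g x) _ _)
  where
  interchange : ∀ a b c d → a + b + (c + d) ≡ a + c + (b + d)
  interchange = solve-∀

Σ-scale : {X : Set} (c : ℤ) (f : X → ℤ) (xs : List X) → Σ (λ x → c * f x) xs ≡ c * Σ f xs
Σ-scale c f [] = sym (ℤP.*-zeroʳ c)
Σ-scale c f (x ∷ xs) =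
  trans (cong (_+_ (c * f x)) (Σ-scale c f xs)) (sym (ℤP.*-distribˡ-+ c (f x) (Σ f xs)))

Σ-zero : {X : Set} (xs : List X) → Σ (λ _ → + 0) xs ≡ + 0
Σ-zero [] = refl
Σ-zero (x ∷ xs) = trans (ℤP.+-identityˡ _) (Σ-zero xs)

sum-Σ-comm : {X : Set} (n : ℕ) (h : Fin n → X → ℤ) (xs : List X) →
  sum (λ i → Σ (h i) xs) ≡ Σ (λ x → sum (λ i → h i x)) xs
sum-Σ-comm zero h xs = sym (Σ-zero xs)
sum-Σ-comm (suc n) h xs =
  trans (cong (_+_ (Σ (h Fin.zero) xs)) (sum-Σ-comm n (λ i → h (Fin.suc i)) xs))
        (sym (Σ-+ (h Fin.zero) _ xs))

blockSpread : Block → ℤ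
blockSpread B = (if isOpen B then + 0 else + maxB B) - + minB B + 1ℤ

-- spread π = Σ_B blockSpread B is additive over blocks and does not involve n.
spread : MSP → ℤ
spread = Σ blockSpread

dtilde-spread : ∀ N π → dtilde N π ≡ spread π + + N * (+ o π - 1ℤ)
dtilde-spread N π = cong (_+ + N * (+ o π - 1ℤ)) (spread-split π)
  where
  closedMax : Block → ℤ
  closedMax B = if isOpen B then + 0 else + maxB B

  spread-split : ∀ π → Σ closedMax π - Σ (λ B → + minB B) π + + ℓ π ≡ spread π
  spread-split [] = refl
  spread-split (B ∷ π) =
    trans (regroup (closedMax B) (+ minB B) (Σ closedMax π) (Σ (λ B → + minB B) π) (+ ℓ π))
          (cong (_+_ (blockSpread B)) (spread-split π))
    where
    regroup : ∀ c m C M l → (c + C) - (m + M) + (1ℤ + l) ≡ (c - m + 1ℤ) + (C - M + l)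
    regroup = solve-∀

-- Every block of π has its maximum ≤ m, so m can be inserted on top of any block.
BoundedBy : ℕ → MSP → Set
BoundedBy m π = All (λ B → maxB B ≤ m) π

minB≤maxB : ∀ B → minB B ≤ maxB B
minB≤maxB ((y L⁺.∷ []) , _) = ≤-refl
minB≤maxB ((y L⁺.∷ (z ∷ zs)) , _) = ≤-trans (m⊓n≤m y _) (m≤m⊔n y _)

maxB-insert : ∀ m b x → maxB (b , x) ≤ m → maxB (m ∷⁺ b , x) ≡ m
maxB-insert m (y L⁺.∷ ys) x bound = m≥n⇒m⊔n≡m bound

minB-insert : ∀ m b x → maxB (b , x) ≤ m → minB (m ∷⁺ b , x) ≡ minB (b , x)
minB-insert m (y L⁺.∷ ys) x bound =
  m≥n⇒m⊓n≡n (≤-trans (minB≤maxB ((y L⁺.∷ ys) , x)) bound)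

spread-insertOpen : ∀ m b → maxB (b , true) ≤ m →
  blockSpread (m ∷⁺ b , true) ≡ blockSpread (b , true)
spread-insertOpen m b bound = cong (λ v → + 0 - + v + 1ℤ) (minB-insert m b true bound)

spread-insertClosed : ∀ m b → maxB (b , false) ≤ m →
  blockSpread (m ∷⁺ b , false) ≡ blockSpread (b , true) + + m
spread-insertClosed m b bound =
  trans (cong₂ (λ u v → + u - + v + 1ℤ) (maxB-insert m b false bound) (minB-insert m b false bound))
        (regroup (+ m) (+ minB (b , true)))
  where
  regroup : ∀ m v → m - v + 1ℤ ≡ + 0 - v + 1ℤ + m
  regroup = solve-∀

insEach-bounded : ∀ m π → BoundedBy m π → All (BoundedBy m) (insEach m π)
insEach-bounded m [] [] = []
insEach-bounded m ((b , x) ∷ π) (bound ∷ bounds) =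
  (≤-reflexive (maxB-insert m b x bound) ∷ bounds)
    ∷ AllP.map⁺ (All.map (bound ∷_) (insEach-bounded m π bounds))

msps-bounded : ∀ N → All (BoundedBy N) (msps N)
msps-bounded zero = [] ∷ []
msps-bounded (suc N) = AllP.concat⁺ (AllP.map⁺ (All.map extend-bounded (msps-bounded N)))
  where
  extend-bounded : ∀ {π} → BoundedBy N π → All (BoundedBy (suc N)) (extend (suc N) π)
  extend-bounded bounds =
    (≤-refl ∷ bounds′) ∷ (≤-refl ∷ bounds′) ∷ insEach-bounded (suc N) _ bounds′
    where bounds′ = All.map m≤n⇒m≤1+n bounds

openOne : MSP → List MSP
openOne [] = []
openOne ((b , true) ∷ π) = map ((b , true) ∷_) (openOne π)
openOne ((b , false) ∷ π) = ((b , true) ∷ π) ∷ map ((b , false) ∷_) (openOne π)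

insEach-o : ∀ m π → All (λ μ → o μ ≡ o π) (insEach m π)
insEach-o m [] = []
insEach-o m ((b , true) ∷ π) = refl ∷ AllP.map⁺ (All.map (cong suc) (insEach-o m π))
insEach-o m ((b , false) ∷ π) = refl ∷ AllP.map⁺ (insEach-o m π)

openOne-insEach : ∀ m π (h : MSP → ℤ) →
  Σ (λ μ → Σ h (openOne μ)) (insEach m π) ≡ Σ (λ ν → Σ h (insEach m ν)) (openOne π)
openOne-insEach m [] h = refl
openOne-insEach m ((b , true) ∷ π) h = begin
  Σ h (openOne (B⁺ ∷ π)) + Σ (λ μ → Σ h (openOne μ)) (map (B ∷_) (insEach m π))
    ≡⟨ cong₂ _+_ (Σ-map h _ (openOne π)) (Σ-map _ _ (insEach m π)) ⟩
  Σ (λ ν → h (B⁺ ∷ ν)) (openOne π) + Σ (λ μ → Σ h (map (B ∷_) (openOne μ))) (insEach m π)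
    ≡⟨ cong (_+_ (Σ (λ ν → h (B⁺ ∷ ν)) (openOne π)))
         (trans (Σ-cong (λ μ → Σ-map h _ (openOne μ)) (insEach m π)) (openOne-insEach m π _)) ⟩
  Σ (λ ν → h (B⁺ ∷ ν)) (openOne π) + Σ (λ ν → Σ (λ μ → h (B ∷ μ)) (insEach m ν)) (openOne π)
    ≡⟨ sym (Σ-+ _ _ (openOne π)) ⟩
  Σ (λ ν → h (B⁺ ∷ ν) + Σ (λ μ → h (B ∷ μ)) (insEach m ν)) (openOne π)
    ≡⟨ Σ-cong (λ ν → cong (_+_ (h (B⁺ ∷ ν))) (sym (Σ-map h _ (insEach m ν)))) (openOne π) ⟩
  Σ (λ ν → Σ h (insEach m (B ∷ ν))) (openOne π)
    ≡⟨ sym (Σ-map _ _ (openOne π)) ⟩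
  Σ (λ ν → Σ h (insEach m ν)) (openOne (B ∷ π)) ∎
  where
  open ≡-Reasoning
  B B⁺ : Block
  B = (b , true)
  B⁺ = (m ∷⁺ b , true)
openOne-insEach m ((b , false) ∷ π) h = begin
  Σ h (openOne (Bc⁺ ∷ π)) + Σ (λ μ → Σ h (openOne μ)) (map (Bc ∷_) (insEach m π))
    ≡⟨ cong₂ _+_ (cong (_+_ (h (Bo⁺ ∷ π))) (Σ-map h _ (openOne π))) (Σ-map _ _ (insEach m π)) ⟩
  (h (Bo⁺ ∷ π) + P) + Σ (λ μ → h (Bo ∷ μ) + Σ h (map (Bc ∷_) (openOne μ))) (insEach m π)
    ≡⟨ cong (_+_ (h (Bo⁺ ∷ π) + P))
         (trans (Σ-+ _ _ (insEach m π)) (cong (_+_ Q)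
           (trans (Σ-cong (λ μ → Σ-map h _ (openOne μ)) (insEach m π)) (openOne-insEach m π _)))) ⟩
  (h (Bo⁺ ∷ π) + P) + (Q + R)
    ≡⟨ interchange (h (Bo⁺ ∷ π)) P Q R ⟩
  (h (Bo⁺ ∷ π) + Q) + (P + R)
    ≡⟨ cong₂ _+_ (cong (_+_ (h (Bo⁺ ∷ π))) (sym (Σ-map h _ (insEach m π))))
         (trans (sym (Σ-+ _ _ (openOne π)))
           (trans (Σ-cong (λ ν → cong (_+_ (h (Bc⁺ ∷ ν))) (sym (Σ-map h _ (insEach m ν)))) (openOne π))
             (sym (Σ-map _ _ (openOne π))))) ⟩
  Σ (λ ν → Σ h (insEach m ν)) (openOne (Bc ∷ π)) ∎
  where
  open ≡-Reasoning
  Bc Bc⁺ Bo Bo⁺ : Block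
  Bc = (b , false)
  Bc⁺ = (m ∷⁺ b , false)
  Bo = (b , true)
  Bo⁺ = (m ∷⁺ b , true)
  P = Σ (λ ν → h (Bc⁺ ∷ ν)) (openOne π)
  Q = Σ (λ μ → h (Bo ∷ μ)) (insEach m π)
  R = Σ (λ ν → Σ (λ μ → h (Bc ∷ μ)) (insEach m ν)) (openOne π)
  interchange : ∀ a p q r → (a + p) + (q + r) ≡ (a + q) + (p + r)
  interchange = solve-∀

-- Double counting: a partition with k open blocks arises by opening one
-- closed block in exactly k ways, so summing h over all openings of all
-- partitions of [N] weights each partition by its number of open blocks.
opening-sum : ∀ N (h : MSP → ℤ) →
  Σ (λ π → Σ h (openOne π)) (msps N) ≡ Σ (λ π → + o π * h π) (msps N)
opening-sum zero h = refl
opening-sum (suc N) h = begin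
  Σ (λ π → Σ h (openOne π)) (concatMap (extend m) (msps N))
    ≡⟨ Σ-concatMap _ _ (msps N) ⟩
  Σ (λ π → Σ (λ μ → Σ h (openOne μ)) (extend m π)) (msps N)
    ≡⟨ Σ-cong openings-of-extensions (msps N) ⟩
  Σ (λ π → h (So ∷ π) + Σ h⁺ (openOne π)) (msps N)
    ≡⟨ Σ-+ _ _ (msps N) ⟩
  Σ (λ π → h (So ∷ π)) (msps N) + Σ (λ π → Σ h⁺ (openOne π)) (msps N)
    ≡⟨ cong (_+_ (Σ (λ π → h (So ∷ π)) (msps N))) (opening-sum N h⁺) ⟩
  Σ (λ π → h (So ∷ π)) (msps N) + Σ (λ π → + o π * h⁺ π) (msps N)
    ≡⟨ sym (Σ-+ _ _ (msps N)) ⟩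
  Σ (λ π → h (So ∷ π) + + o π * h⁺ π) (msps N)
    ≡⟨ sym (Σ-cong weighted-extensions (msps N)) ⟩
  Σ (λ π → Σ (λ μ → + o μ * h μ) (extend m π)) (msps N)
    ≡⟨ sym (Σ-concatMap _ _ (msps N)) ⟩
  Σ (λ π → + o π * h π) (concatMap (extend m) (msps N)) ∎
  where
  open ≡-Reasoning
  m = suc N
  So Sc : Block
  So = (L⁺.[ m ] , true)
  Sc = (L⁺.[ m ] , false)
  h⁺ : MSP → ℤ
  h⁺ ν = Σ h (extend m ν)
  openings-of-extensions : ∀ π →
    Σ (λ μ → Σ h (openOne μ)) (extend m π) ≡ h (So ∷ π) + Σ h⁺ (openOne π)
  openings-of-extensions π = begin
    Σ h (map (So ∷_) (openOne π)) + ((h (So ∷ π) + Σ h (map (Sc ∷_) (openOne π)))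
      + Σ (λ μ → Σ h (openOne μ)) (insEach m π))
      ≡⟨ cong₂ _+_ (Σ-map h _ (openOne π))
           (cong₂ _+_ (cong (_+_ (h (So ∷ π))) (Σ-map h _ (openOne π))) (openOne-insEach m π h)) ⟩
    X + ((h (So ∷ π) + Y) + Z)
      ≡⟨ regroup X Y Z (h (So ∷ π)) ⟩
    h (So ∷ π) + (X + (Y + Z))
      ≡⟨ cong (_+_ (h (So ∷ π))) (sym (trans (Σ-+ _ _ (openOne π)) (cong (_+_ X) (Σ-+ _ _ (openOne π))))) ⟩
    h (So ∷ π) + Σ h⁺ (openOne π) ∎
    where
    X = Σ (λ ν → h (So ∷ ν)) (openOne π)
    Y = Σ (λ ν → h (Sc ∷ ν)) (openOne π)
    Z = Σ (λ ν → Σ h (insEach m ν)) (openOne π)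
    regroup : ∀ x y z s → x + ((s + y) + z) ≡ s + (x + (y + z))
    regroup = solve-∀
  weighted-extensions : ∀ π → Σ (λ μ → + o μ * h μ) (extend m π) ≡ h (So ∷ π) + + o π * h⁺ π
  weighted-extensions π = begin
    + suc (o π) * h (So ∷ π) + (+ o π * h (Sc ∷ π) + Σ (λ μ → + o μ * h μ) (insEach m π))
      ≡⟨ cong (λ z → + suc (o π) * h (So ∷ π) + (+ o π * h (Sc ∷ π) + z))
           (trans (Σ-congAll (λ o≡ → cong (λ k → + k * h _) o≡) (insEach-o m π))
                  (Σ-scale (+ o π) h (insEach m π))) ⟩
    (1ℤ + + o π) * h (So ∷ π) + (+ o π * h (Sc ∷ π) + + o π * Σ h (insEach m π))
      ≡⟨ regroup (+ o π) (h (So ∷ π)) (h (Sc ∷ π)) (Σ h (insEach m π)) ⟩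
    h (So ∷ π) + + o π * h⁺ π ∎
    where
    regroup : ∀ k x y z → (1ℤ + k) * x + (k * y + k * z) ≡ x + k * (x + (y + z))
    regroup = solve-∀

-- Inserting m into each block of a bounded partition π, with the result
-- measured by a weight W of (o, spread): an open block keeps both statistics
-- (o π choices in all); a closed block gives the statistics of π with that
-- block opened, the spread shifted by m and one open block fewer.  The latter
-- is recorded by any weight V with V (k+1) t = W k (t + m).
insEach-sum : ∀ m π → BoundedBy m π →
  (W V : ℕ → ℤ → ℤ) → (∀ k t → V (suc k) t ≡ W k (t + + m)) →
  Σ (λ μ → W (o μ) (spread μ)) (insEach m π)
    ≡ + o π * W (o π) (spread π) + Σ (λ ν → V (o ν) (spread ν)) (openOne π)
insEach-sum m [] [] W V shift = refl
insEach-sum m ((b , true) ∷ π) (bound ∷ bounds) W V shift = begin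
  W (o π′) (blockSpread (m ∷⁺ b , true) + spread π)
    + Σ (λ μ → W (o μ) (spread μ)) (map (B ∷_) (insEach m π))
    ≡⟨ cong₂ _+_ (cong (λ u → W (o π′) (u + spread π)) (spread-insertOpen m b bound))
                 (Σ-map _ _ (insEach m π)) ⟩
  X + Σ (λ μ → W′ (o μ) (spread μ)) (insEach m π)
    ≡⟨ cong (_+_ X) (insEach-sum m π bounds W′ V′ shift′) ⟩
  X + (+ o π * X + T)
    ≡⟨ regroup X (+ o π) T ⟩
  + o π′ * X + T
    ≡⟨ cong (_+_ (+ o π′ * X)) (sym (Σ-map _ _ (openOne π))) ⟩
  + o π′ * X + Σ (λ ν → V (o ν) (spread ν)) (openOne π′) ∎
  where
  open ≡-Reasoning
  B = (b , true)
  π′ = B ∷ π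
  W′ V′ : ℕ → ℤ → ℤ
  W′ k t = W (suc k) (blockSpread B + t)
  V′ k t = V (suc k) (blockSpread B + t)
  shift′ : ∀ k t → V′ (suc k) t ≡ W′ k (t + + m)
  shift′ k t = trans (shift _ _) (cong (W (suc k)) (ℤP.+-assoc (blockSpread B) t (+ m)))
  X = W (o π′) (spread π′)
  T = Σ (λ ν → V′ (o ν) (spread ν)) (openOne π)
  regroup : ∀ x k t → x + (k * x + t) ≡ (1ℤ + k) * x + t
  regroup = solve-∀
insEach-sum m ((b , false) ∷ π) (bound ∷ bounds) W V shift = begin
  W (o π) (blockSpread (m ∷⁺ b , false) + spread π)
    + Σ (λ μ → W (o μ) (spread μ)) (map (Bc ∷_) (insEach m π))
    ≡⟨ cong₂ _+_ (cong (λ u → W (o π) (u + spread π)) (spread-insertClosed m b bound))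
                 (Σ-map _ _ (insEach m π)) ⟩
  W (o π) (blockSpread Bo + + m + spread π) + Σ (λ μ → W′ (o μ) (spread μ)) (insEach m π)
    ≡⟨ cong₂ _+_ (trans (cong (W (o π)) (swap (blockSpread Bo) (+ m) (spread π))) (sym (shift _ _)))
                 (insEach-sum m π bounds W′ V′ shift′) ⟩
  Y + (+ o π * X + T)
    ≡⟨ regroup Y (+ o π * X) T ⟩
  + o π * X + (Y + T)
    ≡⟨ cong (λ z → + o π * X + (Y + z)) (sym (Σ-map _ _ (openOne π))) ⟩
  + o π * X + Σ (λ ν → V (o ν) (spread ν)) (openOne (Bc ∷ π)) ∎
  where
  open ≡-Reasoning
  Bc Bo : Block
  Bc = (b , false)
  Bo = (b , true)
  W′ V′ : ℕ → ℤ → ℤ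
  W′ k t = W k (blockSpread Bc + t)
  V′ k t = V k (blockSpread Bc + t)
  shift′ : ∀ k t → V′ (suc k) t ≡ W′ k (t + + m)
  shift′ k t = trans (shift _ _) (cong (W k) (ℤP.+-assoc (blockSpread Bc) t (+ m)))
  X = W (o (Bc ∷ π)) (spread (Bc ∷ π))
  Y = V (o (Bo ∷ π)) (spread (Bo ∷ π))
  T = Σ (λ ν → V′ (o ν) (spread ν)) (openOne π)
  swap : ∀ s m t → s + m + t ≡ s + t + m
  swap = solve-∀
  regroup : ∀ y x t → y + (x + t) ≡ x + (y + t)
  regroup = solve-∀

-- Recursion for sums over partitions of [N+1] weighted by (o, spread): adding
-- N+1 as an open singleton, as a closed singleton, into an open block, or into
-- a closed block (counted via opening-sum).
spreadSum-suc : ∀ N (W : ℕ → ℤ → ℤ) →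
  Σ (λ μ → W (o μ) (spread μ)) (msps (suc N))
    ≡ Σ (λ π → W (suc (o π)) (spread π - + N) + W (o π) (spread π + 1ℤ)
               + + o π * (W (o π) (spread π) + W (pred (o π)) (spread π + + suc N))) (msps N)
spreadSum-suc N W = begin
  Σ w (concatMap (extend m) (msps N))
    ≡⟨ Σ-concatMap w (extend m) (msps N) ⟩
  Σ (λ π → Σ w (extend m π)) (msps N)
    ≡⟨ Σ-congAll per-partition (All.map (All.map m≤n⇒m≤1+n) (msps-bounded N)) ⟩
  Σ (λ π → fresh π + Σ v (openOne π)) (msps N)
    ≡⟨ Σ-+ _ _ (msps N) ⟩
  Σ fresh (msps N) + Σ (λ π → Σ v (openOne π)) (msps N)
    ≡⟨ cong (_+_ (Σ fresh (msps N))) (opening-sum N v) ⟩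
  Σ fresh (msps N) + Σ (λ π → + o π * v π) (msps N)
    ≡⟨ sym (Σ-+ _ _ (msps N)) ⟩
  Σ (λ π → fresh π + + o π * v π) (msps N)
    ≡⟨ Σ-cong (λ π → regroup (newOpen π) (newClosed π) (+ o π) (w π) (v π)) (msps N) ⟩
  Σ (λ π → W (suc (o π)) (spread π - + N) + W (o π) (spread π + 1ℤ)
           + + o π * (W (o π) (spread π) + W (pred (o π)) (spread π + + m))) (msps N) ∎
  where
  open ≡-Reasoning
  m = suc N
  w v : MSP → ℤ
  w μ = W (o μ) (spread μ)
  v ν = W (pred (o ν)) (spread ν + + m)
  newOpen newClosed : MSP → ℤ
  newOpen π = W (suc (o π)) (spread π - + N)
  newClosed π = W (o π) (spread π + 1ℤ)
  -- the extensions not produced by insertion into a closed block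
  fresh : MSP → ℤ
  fresh π = newOpen π + newClosed π + + o π * w π
  per-partition : ∀ {π} → BoundedBy m π → Σ w (extend m π) ≡ fresh π + Σ v (openOne π)
  per-partition {π} bounds = begin
    W (suc (o π)) (+ 0 - + m + 1ℤ + spread π)
      + (W (o π) (+ m - + m + 1ℤ + spread π) + Σ w (insEach m π))
      ≡⟨ cong₂ _+_ (cong (W (suc (o π))) (open-singleton (+ N) (spread π)))
           (cong₂ _+_ (cong (W (o π)) (closed-singleton (+ m) (spread π)))
                      (insEach-sum m π bounds W (λ k t → W (pred k) (t + + m)) (λ _ _ → refl))) ⟩
    W (suc (o π)) (spread π - + N) + (W (o π) (spread π + 1ℤ) + (+ o π * w π + Σ v (openOne π)))
      ≡⟨ regroup′ (newOpen π) (newClosed π) (+ o π * w π) (Σ v (openOne π)) ⟩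
    fresh π + Σ v (openOne π) ∎
    where
    open-singleton : ∀ n t → + 0 - (1ℤ + n) + 1ℤ + t ≡ t - n
    open-singleton = solve-∀
    closed-singleton : ∀ m t → m - m + 1ℤ + t ≡ t + 1ℤ
    closed-singleton = solve-∀
    regroup′ : ∀ a b c d → a + (b + (c + d)) ≡ a + b + c + d
    regroup′ = solve-∀
  regroup : ∀ a b k x y → a + b + k * x + k * y ≡ a + b + k * (x + y)
  regroup = solve-∀

-- The weight that a partition of [N] with k open blocks and d̃ = d passes on
-- to its extensions to [N+1]: N+1 as an open singleton (k+1, d+k), as a closed
-- singleton (k, d+k), inserted into one of the k open blocks (k, d+k−1), or
-- into a closed block, which after opening-sum counts k times as (k−1, d+k−1).
extensionWeight : (ℕ → ℤ → ℤ) → ℕ → ℤ → ℤ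
extensionWeight W zero d = W 1 (d + + 0) + W 0 (d + + 0)
extensionWeight W (suc k) d =
  W (suc (suc k)) (d + + suc k) + W (suc k) (d + + suc k)
    + + suc k * (W (suc k) (d + + k) + W k (d + + k))

moment-suc : ∀ N (W : ℕ → ℤ → ℤ) →
  Σ (λ μ → W (o μ) (dtilde (suc N) μ)) (msps (suc N))
    ≡ Σ (λ π → extensionWeight W (o π) (dtilde N π)) (msps N)
moment-suc N W =
  trans (Σ-cong (λ μ → cong (W (o μ)) (dtilde-spread (suc N) μ)) (msps (suc N)))
  (trans (spreadSum-suc N W′)
         (Σ-cong (λ π → trans (in-terms-of-dtilde (o π) (spread π))
                              (cong (extensionWeight W (o π)) (sym (dtilde-spread N π)))) (msps N)))
  where
  W′ : ℕ → ℤ → ℤ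
  W′ k t = W k (t + + suc N * (+ k - 1ℤ))
  -- the right-hand side of spreadSum-suc for W′, rewritten with d = t + N (k − 1)
  in-terms-of-dtilde : ∀ k t →
    W′ (suc k) (t - + N) + W′ k (t + 1ℤ) + + k * (W′ k t + W′ (pred k) (t + + suc N))
      ≡ extensionWeight W k (t + + N * (+ k - 1ℤ))
  in-terms-of-dtilde zero t =
    trans (cong₂ (λ u v → W 1 u + W 0 v + + 0 * (W′ 0 t + W′ 0 (t + + suc N)))
                 (new-open t (+ N)) (new-closed t (+ N)))
          (ℤP.+-identityʳ _)
    where
    new-open : ∀ t n → t - n + (1ℤ + n) * (1ℤ - 1ℤ) ≡ t + n * (+ 0 - 1ℤ) + + 0
    new-open = solve-∀
    new-closed : ∀ t n → t + 1ℤ + (1ℤ + n) * (+ 0 - 1ℤ) ≡ t + n * (+ 0 - 1ℤ) + + 0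
    new-closed = solve-∀
  in-terms-of-dtilde (suc k) t =
    cong₂ _+_ (cong₂ _+_ (cong (W (suc (suc k))) (new-open t (+ N) (+ k)))
                         (cong (W (suc k)) (new-closed t (+ N) (+ k))))
              (cong (_*_ (+ suc k)) (cong₂ _+_ (cong (W (suc k)) (into-open t (+ N) (+ k)))
                                              (cong (W k) (into-closed t (+ N) (+ k)))))
    where
    new-open : ∀ t n k →
      t - n + (1ℤ + n) * ((1ℤ + (1ℤ + k)) - 1ℤ) ≡ t + n * ((1ℤ + k) - 1ℤ) + (1ℤ + k)
    new-open = solve-∀
    new-closed : ∀ t n k →
      t + 1ℤ + (1ℤ + n) * ((1ℤ + k) - 1ℤ) ≡ t + n * ((1ℤ + k) - 1ℤ) + (1ℤ + k)
    new-closed = solve-∀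
    into-open : ∀ t n k → t + (1ℤ + n) * ((1ℤ + k) - 1ℤ) ≡ t + n * ((1ℤ + k) - 1ℤ) + k
    into-open = solve-∀
    into-closed : ∀ t n k → t + (1ℤ + n) + (1ℤ + n) * (k - 1ℤ) ≡ t + n * ((1ℤ + k) - 1ℤ) + k
    into-closed = solve-∀

δ : ℕ → ℕ → ℤ
δ i j = if i ≡ᵇ j then 1ℤ else + 0

δ-subst : ∀ i j (f : ℕ → ℤ) → δ i j * f i ≡ δ i j * f j
δ-subst zero zero f = refl
δ-subst zero (suc j) f = refl
δ-subst (suc i) zero f = refl
δ-subst (suc i) (suc j) f = δ-subst i j (λ k → f (suc k))

if-as-δ : ∀ i j x → (if i ≡ᵇ j then x else + 0) ≡ δ i j * x
if-as-δ zero zero x = sym (ℤP.*-identityˡ x)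
if-as-δ zero (suc j) x = refl
if-as-δ (suc i) zero x = refl
if-as-δ (suc i) (suc j) x = if-as-δ i j x

coeffWeight : ℕ → ℕ → ℕ → ℤ → ℤ
coeffWeight n A k d = δ k A * d ^ n

Fk-moment : ∀ n N A → Fk n N A ≡ Σ (λ π → coeffWeight n A (o π) (dtilde N π)) (msps N)
Fk-moment n N A = Σ-cong (λ π → if-as-δ (o π) A (dtilde N π ^ n)) (msps N)

-- The coefficient of Y^a in (1 + ∂/∂Y) Y^k = Y^k + k Y^(k−1).
onePlus∂Y-coeff : ℕ → ℕ → ℤ
onePlus∂Y-coeff a k = δ k a + + suc a * δ k (suc a)

density : ℕ → ℕ → ℕ → ℤ → ℤ
density n a k d = onePlus∂Y-coeff a k * (d + + a) ^ n

-- The extension weight of [k = A] dⁿ is the Y^A-coefficient of (1 + Y) applied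
-- to Σ_a density n a k d Y^a; for A = 0 only the first term survives.
extension-coeff-zero : ∀ n k d → extensionWeight (coeffWeight n 0) k d ≡ density n 0 k d
extension-coeff-zero n zero d = regroup ((d + + 0) ^ n)
  where
  regroup : ∀ x → + 0 * x + 1ℤ * x ≡ (1ℤ + + 1 * + 0) * x
  regroup = solve-∀
extension-coeff-zero n (suc k) d = begin
  + 0 * X + + 0 * X + + suc k * (+ 0 * (d + + k) ^ n + δ k 0 * (d + + k) ^ n)
    ≡⟨ collect X (+ suc k) (δ k 0) ((d + + k) ^ n) ⟩
  δ k 0 * (+ suc k * (d + + k) ^ n)
    ≡⟨ δ-subst k 0 (λ i → + suc i * (d + + i) ^ n) ⟩
  δ k 0 * (+ 1 * (d + + 0) ^ n)
    ≡⟨ spread-out (δ k 0) ((d + + 0) ^ n) ⟩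
  (+ 0 + + 1 * δ k 0) * (d + + 0) ^ n ∎
  where
  open ≡-Reasoning
  X = (d + + suc k) ^ n
  collect : ∀ x c e y → + 0 * x + + 0 * x + c * (+ 0 * y + e * y) ≡ e * (c * y)
  collect = solve-∀
  spread-out : ∀ e y → e * (+ 1 * y) ≡ (+ 0 + + 1 * e) * y
  spread-out = solve-∀

extension-coeff-suc : ∀ n a k d →
  extensionWeight (coeffWeight n (suc a)) k d ≡ density n (suc a) k d + density n a k d
extension-coeff-suc n a zero d = begin
  δ 0 a * (d + + 0) ^ n + + 0 * (d + + 0) ^ n
    ≡⟨ ℤP.+-identityʳ _ ⟩
  δ 0 a * (d + + 0) ^ n
    ≡⟨ δ-subst 0 a (λ i → (d + + i) ^ n) ⟩
  δ 0 a * (d + + a) ^ n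
    ≡⟨ spread-out (δ 0 a) ((d + + suc a) ^ n) ((d + + a) ^ n) (+ suc a) (+ suc (suc a)) ⟩
  (+ 0 + + suc (suc a) * + 0) * (d + + suc a) ^ n + (δ 0 a + + suc a * + 0) * (d + + a) ^ n ∎
  where
  open ≡-Reasoning
  spread-out : ∀ e p q α β → e * q ≡ (+ 0 + β * + 0) * p + (e + α * + 0) * q
  spread-out = solve-∀
extension-coeff-suc n a (suc k) d = begin
  δ (suc k) a * (d + + suc k) ^ n + δ k a * (d + + suc k) ^ n
    + + suc k * (δ k a * (d + + k) ^ n + δ k (suc a) * (d + + k) ^ n)
    ≡⟨ collect (δ (suc k) a) (δ k a) (δ k (suc a)) (+ suc k) ((d + + suc k) ^ n) ((d + + k) ^ n) ⟩
  δ (suc k) a * (d + + suc k) ^ n + δ k a * (d + + suc k) ^ n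
    + δ k a * (+ suc k * (d + + k) ^ n) + δ k (suc a) * (+ suc k * (d + + k) ^ n)
    ≡⟨ cong₂ _+_ (cong₂ _+_ (cong₂ _+_ (δ-subst (suc k) a (λ i → (d + + i) ^ n))
                                      (δ-subst k a (λ i → (d + + suc i) ^ n)))
                           (δ-subst k a (λ i → + suc i * (d + + i) ^ n)))
                 (δ-subst k (suc a) (λ i → + suc i * (d + + i) ^ n)) ⟩
  δ (suc k) a * (d + + a) ^ n + δ k a * (d + + suc a) ^ n
    + δ k a * (+ suc a * (d + + a) ^ n) + δ k (suc a) * (+ suc (suc a) * (d + + suc a) ^ n)
    ≡⟨ spread-out (δ (suc k) a) (δ k a) (δ k (suc a)) (+ suc a) (+ suc (suc a))
                  ((d + + a) ^ n) ((d + + suc a) ^ n) ⟩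
  (δ k a + + suc (suc a) * δ k (suc a)) * (d + + suc a) ^ n
    + (δ (suc k) a + + suc a * δ k a) * (d + + a) ^ n ∎
  where
  open ≡-Reasoning
  collect : ∀ e₁ e₂ e₃ c x y →
    e₁ * x + e₂ * x + c * (e₂ * y + e₃ * y) ≡ e₁ * x + e₂ * x + e₂ * (c * y) + e₃ * (c * y)
  collect = solve-∀
  spread-out : ∀ e₁ e₂ e₃ α β p q →
    e₁ * p + e₂ * q + e₂ * (α * p) + e₃ * (β * q) ≡ (e₂ + β * e₃) * q + (e₁ + α * e₂) * p
  spread-out = solve-∀

Y∂Y^-coeff : ∀ k s N a → Y∂Y^ k s N a ≡ (+ a) ^ k * s N a
Y∂Y^-coeff zero s N a = sym (ℤP.*-identityˡ _)
Y∂Y^-coeff (suc k) s N a =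
  trans (cong (_*_ (+ a)) (Y∂Y^-coeff k s N a)) (sym (ℤP.*-assoc (+ a) ((+ a) ^ k) (s N a)))

sumFrom1-as-sum : ∀ n (f : ℕ → Series) N a →
  sumFrom1 n f N a ≡ sum {n} (λ i → f (suc (toℕ i)) N a)
sumFrom1-as-sum zero f N a = refl
sumFrom1-as-sum (suc n) f N a = begin
  sumFrom1 n f N a + f (suc n) N a
    ≡⟨ cong₂ _+_ (trans (sumFrom1-as-sum n f N a)
                        (sum-cong-≗ {n} {λ i → f (suc (toℕ i)) N a} {init t}
                                    (λ i → cong (λ j → f (suc j) N a) (sym (toℕ-inject₁ i)))))
                 (cong (λ j → f (suc j) N a) (sym (toℕ-fromℕ n))) ⟩
  sum (init t) + last t
    ≡⟨ sym (sum-init-last t) ⟩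
  sum t ∎
  where
  open ≡-Reasoning
  t : Fin (suc n) → ℤ
  t i = f (suc (toℕ i)) N a

-- The binomial theorem, Σ_{i ≤ n} C(n,i) x^i y^(n−i) = (x + y)ⁿ, restated with
-- the integer operations (the library states it with semiring multiples and powers).
binomial-theorem : ∀ n x y →
  sum {suc n} (λ i → + (n C toℕ i) * (x ^ toℕ i * y ^ (n ∸ toℕ i))) ≡ (x + y) ^ n
binomial-theorem n x y = begin
  sum {suc n} (λ i → + (n C toℕ i) * (x ^ toℕ i * y ^ (n ∸ toℕ i)))
    ≡⟨ sum-cong-≗ {suc n} term-eq ⟩
  Binomial.binomialExpansion x y n
    ≡⟨ sym (Binomial.theorem n x y) ⟩
  (x + y) Exp.^ n
    ≡⟨ ^-as-^ (x + y) n ⟩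
  (x + y) ^ n ∎
  where
  open ≡-Reasoning
  ×-as-* : ∀ m z → m Mult.× z ≡ + m * z
  ×-as-* zero z = refl
  ×-as-* (suc m) z = trans (cong (_+_ z) (×-as-* m z)) (fold (+ m) z)
    where
    fold : ∀ k z → z + k * z ≡ (1ℤ + k) * z
    fold = solve-∀
  ^-as-^ : ∀ z m → z Exp.^ m ≡ z ^ m
  ^-as-^ z zero = refl
  ^-as-^ z (suc m) = cong (_*_ z) (^-as-^ z m)
  term-eq : ∀ i → + (n C toℕ i) * (x ^ toℕ i * y ^ (n ∸ toℕ i)) ≡ Binomial.binomialTerm x y n i
  term-eq i = sym (trans (×-as-* (n C toℕ i) _)
                         (cong (_*_ (+ (n C toℕ i)))
                               (cong₂ _*_ (^-as-^ x (toℕ i)) (^-as-^ y (n ∸ toℕ i)))))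

onePlus∂Y-moment : ∀ j N a →
  onePlus∂Y (Fk j) N a ≡ Σ (λ π → onePlus∂Y-coeff a (o π) * dtilde N π ^ j) (msps N)
onePlus∂Y-moment j N a = begin
  Fk j N a + + suc a * Fk j N (suc a)
    ≡⟨ cong₂ (λ u v → u + + suc a * v) (Fk-moment j N a) (Fk-moment j N (suc a)) ⟩
  Σ (w a) L + + suc a * Σ (w (suc a)) L
    ≡⟨ cong (_+_ (Σ (w a) L)) (sym (Σ-scale (+ suc a) (w (suc a)) L)) ⟩
  Σ (w a) L + Σ (λ π → + suc a * w (suc a) π) L
    ≡⟨ sym (Σ-+ _ _ L) ⟩
  Σ (λ π → w a π + + suc a * w (suc a) π) L
    ≡⟨ Σ-cong (λ π → factor (δ (o π) a) (δ (o π) (suc a)) (+ suc a) (dtilde N π ^ j)) L ⟩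
  Σ (λ π → onePlus∂Y-coeff a (o π) * dtilde N π ^ j) L ∎
  where
  open ≡-Reasoning
  L = msps N
  w : ℕ → MSP → ℤ
  w A π = coeffWeight j A (o π) (dtilde N π)
  factor : ∀ e₁ e₂ α x → e₁ * x + α * (e₂ * x) ≡ (e₁ + α * e₂) * x
  factor = solve-∀

binomialTail : ℕ → Series
binomialTail n = sumFrom1 n (λ k → scale (+ (n C k)) (Y∂Y^ k (onePlus∂Y (Fk (n ∸ k)))))

binomialDensity : ℕ → Series
binomialDensity n N a = Σ (λ π → density n a (o π) (dtilde N π)) (msps N)

-- The k = 0 term (1 + ∂/∂Y) F_n together with the tail is, coefficientwise,
-- one binomial expansion of (d̃ + a)ⁿ inside the moment sum.
binomial-collapse : ∀ n N a → (onePlus∂Y (Fk n) ⊕ binomialTail n) N a ≡ binomialDensity n N a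
binomial-collapse n N a = begin
  onePlus∂Y (Fk n) N a + binomialTail n N a
    ≡⟨ cong₂ _+_ (sym (trans (ℤP.*-identityˡ _) (ℤP.*-identityˡ (onePlus∂Y (Fk n) N a))))
                 (trans (sumFrom1-as-sum n tailSeries N a)
                        (sum-cong-≗ {n} (λ i → tail-term (Fin.suc i)))) ⟩
  term Fin.zero + sum {n} (λ i → term (Fin.suc i))
    ≡⟨⟩
  sum {suc n} term
    ≡⟨ sum-cong-≗ term-as-Σ ⟩
  sum {suc n} (λ i → Σ (λ π → coeff π * binomialTerm i (dtilde N π)) L)
    ≡⟨ sum-Σ-comm (suc n) (λ i π → coeff π * binomialTerm i (dtilde N π)) L ⟩
  Σ (λ π → sum {suc n} (λ i → coeff π * binomialTerm i (dtilde N π))) L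
    ≡⟨ Σ-cong (λ π → expand (coeff π) (dtilde N π)) L ⟩
  binomialDensity n N a ∎
  where
  open ≡-Reasoning
  L = msps N
  tailSeries : ℕ → Series
  tailSeries k = scale (+ (n C k)) (Y∂Y^ k (onePlus∂Y (Fk (n ∸ k))))
  term : Fin (suc n) → ℤ
  term i = + (n C toℕ i) * ((+ a) ^ toℕ i * onePlus∂Y (Fk (n ∸ toℕ i)) N a)
  tail-term : ∀ i → tailSeries (toℕ i) N a ≡ term i
  tail-term i = cong (_*_ (+ (n C toℕ i))) (Y∂Y^-coeff (toℕ i) (onePlus∂Y (Fk (n ∸ toℕ i))) N a)
  coeff : MSP → ℤ
  coeff π = onePlus∂Y-coeff a (o π)
  binomialTerm : Fin (suc n) → ℤ → ℤ
  binomialTerm i d = + (n C toℕ i) * ((+ a) ^ toℕ i * d ^ (n ∸ toℕ i))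
  term-as-Σ : ∀ i → term i ≡ Σ (λ π → coeff π * binomialTerm i (dtilde N π)) L
  term-as-Σ i =
    trans (cong (λ z → c * (α * z)) (onePlus∂Y-moment (n ∸ toℕ i) N a))
    (trans (cong (_*_ c) (sym (Σ-scale α _ L)))
    (trans (sym (Σ-scale c _ L))
           (Σ-cong (λ π → reorder c α (coeff π) (dtilde N π ^ (n ∸ toℕ i))) L)))
    where
    c = + (n C toℕ i)
    α = (+ a) ^ toℕ i
    reorder : ∀ c α φ x → c * (α * (φ * x)) ≡ φ * (c * (α * x))
    reorder = solve-∀
  expand : ∀ φ d → sum {suc n} (λ i → φ * binomialTerm i d) ≡ φ * (d + + a) ^ n
  expand φ d =
    trans (sym (*-distribˡ-sum φ (λ i → binomialTerm i d)))
          (cong (_*_ φ) (trans (binomial-theorem n (+ a) d) (cong (_^ n) (ℤP.+-comm (+ a) d))))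

∂X-Fk-moment : ∀ n N A →
  ∂X (Fk n) N A ≡ Σ (λ π → extensionWeight (coeffWeight n A) (o π) (dtilde N π)) (msps N)
∂X-Fk-moment n N A = trans (Fk-moment n (suc N) A) (moment-suc N (coeffWeight n A))

∂X-Fk : ∀ n N A → ∂X (Fk n) N A ≡ onePlusY (onePlus∂Y (Fk n) ⊕ binomialTail n) N A
∂X-Fk n N zero = begin
  ∂X (Fk n) N 0
    ≡⟨ ∂X-Fk-moment n N 0 ⟩
  Σ (λ π → extensionWeight (coeffWeight n 0) (o π) (dtilde N π)) (msps N)
    ≡⟨ Σ-cong (λ π → extension-coeff-zero n (o π) (dtilde N π)) (msps N) ⟩
  binomialDensity n N 0
    ≡⟨ sym (binomial-collapse n N 0) ⟩
  (onePlus∂Y (Fk n) ⊕ binomialTail n) N 0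
    ≡⟨ sym (ℤP.+-identityʳ _) ⟩
  onePlusY (onePlus∂Y (Fk n) ⊕ binomialTail n) N 0 ∎
  where open ≡-Reasoning
∂X-Fk n N (suc a) = begin
  ∂X (Fk n) N (suc a)
    ≡⟨ ∂X-Fk-moment n N (suc a) ⟩
  Σ (λ π → extensionWeight (coeffWeight n (suc a)) (o π) (dtilde N π)) (msps N)
    ≡⟨ Σ-cong (λ π → extension-coeff-suc n a (o π) (dtilde N π)) (msps N) ⟩
  Σ (λ π → density n (suc a) (o π) (dtilde N π) + density n a (o π) (dtilde N π)) (msps N)
    ≡⟨ Σ-+ _ _ (msps N) ⟩
  binomialDensity n N (suc a) + binomialDensity n N a
    ≡⟨ sym (cong₂ _+_ (binomial-collapse n N (suc a)) (binomial-collapse n N a)) ⟩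
  onePlusY (onePlus∂Y (Fk n) ⊕ binomialTail n) N (suc a) ∎
  where open ≡-Reasoning

onePlusY-⊕ : ∀ s t N A → onePlusY (s ⊕ t) N A ≡ onePlusY s N A + onePlusY t N A
onePlusY-⊕ s t N zero = regroup (s N 0) (t N 0)
  where
  regroup : ∀ x y → x + y + + 0 ≡ x + + 0 + (y + + 0)
  regroup = solve-∀
onePlusY-⊕ s t N (suc a) = regroup (s N (suc a)) (t N (suc a)) (s N a) (t N a)
  where
  regroup : ∀ x y x′ y′ → x + y + (x′ + y′) ≡ x + x′ + (y + y′)
  regroup = solve-∀

lemma5p1 : (n N A : ℕ) → LHS n N A ≡ RHS n N A
lemma5p1 n N A = begin
  ∂X (Fk n) N A - onePlusY G N A
    ≡⟨ cong (_- onePlusY G N A) (trans (∂X-Fk n N A) (onePlusY-⊕ G T N A)) ⟩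
  onePlusY G N A + onePlusY T N A - onePlusY G N A
    ≡⟨ cancel (onePlusY G N A) (onePlusY T N A) ⟩
  onePlusY T N A ∎
  where
  open ≡-Reasoning
  G T : Series
  G = onePlus∂Y (Fk n)
  T = binomialTail n
  cancel : ∀ x y → x + y - x ≡ y
  cancel = solve-∀
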